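{- Let $n\ge3$ be odd, let $f,B_0,C$ be nonzero integers with $B_0\neq-1$ squarefree, and put $B=f^2B_0$. Let $p$ be an odd prime with $p\mid f$ and $p\|C$, and suppose $p^r\|f$ with $r>0$. Set $r'=\lceil(2r-1)/n\rceil n-2r$. Then for every integer $t>0$: $\mathcal{Y}_{B,C}(\mathbb{Z};*_p^t)=\emptyset$ if $t>r$; $\mathcal{Y}_{B,C}(\mathbb{Z};*_p^t)=\emptyset$ if $0<t<r$ and $n\nmid 2t-1$; $\mathcal{Y}_{B,C}(\mathbb{Z};*_p^t)\cong\mathcal{Y}_{Bp^{ -2r},Cp^{r'}}(\mathbb{Z};*_p^0)$ if $t=r$ and $n\nmid 2t-1$; $\mathcal{Y}_{B,C}(\mathbb{Z};*_p^t)\cong\mathcal{Y}_{Bp^{ -2t},Cp^{ -1}}(\mathbb{Z};*_p^0,p\nmid y)$ if $0<t\le r$ and $n\mid 2t-1$.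
   Context: For nonzero integers $B',C'$, $\mathcal{Y}_{B',C'}(\mathbb{Z})$ is the groupoid of primitive integer solutions $[x:y:z]$ of $x^2+B'y^2=C'z^n$, and $\mathcal{Y}_{B',C'}(\mathbb{Z};\text{conditions})$ the full subgroupoid satisfying the conditions. Writing $B'=f'^2B_0$ with the same squarefree $B_0$, put $u=x+f'\sqrt{ -B_0}\,y\in\mathcal{O}_K$, $K=\mathbb{Q}(\sqrt{ -B_0})$; condition $*_p^s$ means $u\in p^s\mathcal{O}_K\smallsetminus p^{s+1}\mathcal{O}_K$. $p^r\|f$ means $v_p(f)=r$. -}

module Defs where

open import Data.Nat as ℕ using (ℕ; suc)
open import Data.Nat.Primality using (Prime)
open import Data.Integer hiding (suc)
open import Data.Integer.Properties hiding (suc-pred)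
open import Data.Integer.Divisibility using (_∣_)
open import Data.Integer.DivMod using (_%ℕ_)
open import Data.Integer.GCD using (gcd)
open import Data.Sign as S using (Sign)
open import Data.Product using (Σ; ∃; _×_; _,_; proj₁)
open import Data.Sum using (_⊎_)
open import Relation.Nullary using (¬_)
open import Relation.Binary.PropositionalEquality

_^_∥_ : ℕ → ℕ → ℤ → Set
p ^ r ∥ a = ((+ p) ^ r ∣ a) × ¬ ((+ p) ^ (suc r) ∣ a)

Squarefree : ℤ → Set
Squarefree a = ∀ (d : ℤ) → (d * d) ∣ a → ∣ d ∣ ≡ 1

-- Membership of u = x + f'√(-B₀) y in p^s 𝒪_K,  K = ℚ(√-B₀).
-- 𝒪_K = ℤ[(1+√-B₀)/2] = {(a + b√-B₀)/2 : a ≡ b mod 2} if -B₀ ≡ 1 mod 4,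
-- 𝒪_K = ℤ[√-B₀]                                       otherwise.
-- u ∈ p^s 𝒪_K  ⇔  u / p^s ∈ 𝒪_K.

InPowOK : (p s : ℕ) (B₀ f' x y : ℤ) → Set
InPowOK p s B₀ f' x y =
    ((- B₀) %ℕ 4 ≡ 1 ×
       Σ ℤ λ a → Σ ℤ λ b →
         (+ 2 * x ≡ (+ p) ^ s * a) × (+ 2 * (f' * y) ≡ (+ p) ^ s * b) × (+ 2 ∣ (a - b)))
  ⊎ (¬ ((- B₀) %ℕ 4 ≡ 1) ×
       Σ ℤ λ a → Σ ℤ λ b →
         (x ≡ (+ p) ^ s * a) × (f' * y ≡ (+ p) ^ s * b))

Star : (p s : ℕ) (B₀ f' x y : ℤ) → Set
Star p s B₀ f' x y = InPowOK p s B₀ f' x y × ¬ InPowOK p (suc s) B₀ f' x y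

-- The groupoid 𝒴_{B',C'}(ℤ; P) of primitive integer solutions [x:y:z]
-- of x² + B' y² = C' zⁿ, points of the weighted projective stack
-- ℙ(n,n,2): morphisms are units λ ∈ ℤ^× = {±1} with
-- (λⁿx, λⁿy, λ²z) = (x', y', z').

record Obj (n : ℕ) (B' C' : ℤ) (P : ℤ → ℤ → ℤ → Set) : Set where
  constructor sol
  field
    x y z : ℤ
    eqn   : x * x + B' * (y * y) ≡ C' * z ^ n
    prim  : gcd (gcd x y) z ≡ + 1
    cond  : P x y z
open Obj public

Triple : Set
Triple = ℤ × ℤ × ℤ

σ : Sign → ℤ
σ S.+ = + 1
σ S.- = -[1+ 0 ]

act : ℕ → Sign → Triple → Triple
act n s (x , y , z) = (σ s ^ n * x , σ s ^ n * y , σ s ^ 2 * z)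

triple : ∀ {n B' C' P} → Obj n B' C' P → Triple
triple a = (x a , y a , z a)

record Hom {n B' C' P} (a b : Obj n B' C' P) : Set where
  constructor hom
  field
    unit : Sign
    prf  : act n unit (triple a) ≡ triple b
open Hom public
-- equality of morphisms = equality of the underlying units

private
  σ-* : ∀ t s → σ (t S.* s) ≡ σ t * σ s
  σ-* S.- S.- = refl
  σ-* S.- S.+ = refl
  σ-* S.+ S.- = refl
  σ-* S.+ S.+ = refl

  pow-* : ∀ a b k → (a * b) ^ k ≡ a ^ k * b ^ k
  pow-* a b ℕ.zero = refl
  pow-* a b (suc k) rewrite pow-* a b k =
    trans (*-assoc a b (a ^ k * b ^ k))
     (trans (cong (a *_) (trans (sym (*-assoc b (a ^ k) (b ^ k)))
              (trans (cong (_* b ^ k) (*-comm b (a ^ k))) (*-assoc (a ^ k) b (b ^ k)))))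
        (sym (*-assoc a (a ^ k) (b * b ^ k))))

  step : ∀ t s k v → σ (t S.* s) ^ k * v ≡ σ t ^ k * (σ s ^ k * v)
  step t s k v rewrite σ-* t s | pow-* (σ t) (σ s) k = *-assoc (σ t ^ k) (σ s ^ k) v

act-∘ : ∀ n t s v → act n (t S.* s) v ≡ act n t (act n s v)
act-∘ n t s (x , y , z) rewrite step t s n x | step t s n y | step t s 2 z = refl

act-id : ∀ n v → act n S.+ v ≡ v
act-id n (x , y , z) rewrite ^-zeroˡ n = cong₂ _,_ (*-identityˡ x) (cong₂ _,_ (*-identityˡ y) (*-identityˡ z))

idH : ∀ {n B' C' P} (a : Obj n B' C' P) → Hom a a
idH {n} a = hom S.+ (act-id n (triple a))

_∘H_ : ∀ {n B' C' P} {a b c : Obj n B' C' P} → Hom b c → Hom a b → Hom a c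
_∘H_ {n} {a = a} (hom t q) (hom s p) =
  hom (t S.* s) (trans (act-∘ n t s (triple a)) (trans (cong (act n t) p) q))

record Equiv (n : ℕ) (B₁ C₁ : ℤ) (P₁ : ℤ → ℤ → ℤ → Set)
             (B₂ C₂ : ℤ) (P₂ : ℤ → ℤ → ℤ → Set) : Set where
  field
    F₀       : Obj n B₁ C₁ P₁ → Obj n B₂ C₂ P₂
    F₁       : ∀ {a b} → Hom a b → Hom (F₀ a) (F₀ b)
    F-id     : ∀ a → unit (F₁ (idH a)) ≡ unit (idH (F₀ a))
    F-∘      : ∀ {a b c} (g : Hom b c) (h : Hom a b) →
               unit (F₁ (g ∘H h)) ≡ unit (F₁ g ∘H F₁ h)
    full     : ∀ {a b} (h : Hom (F₀ a) (F₀ b)) →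
               Σ (Hom a b) λ g → unit (F₁ g) ≡ unit h
    faithful : ∀ {a b} (g h : Hom a b) → unit (F₁ g) ≡ unit (F₁ h) → unit g ≡ unit h
    esssurj  : ∀ b → Σ (Obj n B₁ C₁ P₁) λ a → Hom (F₀ a) b

Empty : (n : ℕ) (B' C' : ℤ) (P : ℤ → ℤ → ℤ → Set) → Set
Empty n B' C' P = ¬ Obj n B' C' P

-- r' = ⌈(2r-1)/n⌉ n - 2r  (as a natural number: only used when n ∤ 2r-1,
-- where it is ≥ 0)
r′ : ℕ → ℕ → ℕ
r′ ℕ.zero    r = 0   -- junk value, n ≥ 3 in the theorem
r′ n@(suc _) r = ((2 ℕ.* r ℕ.∸ 1 ℕ.+ n ℕ.∸ 1) ℕ./ n) ℕ.* n ℕ.∸ 2 ℕ.* r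

-- As p is odd, *ₚᵗ says that pᵗ divides x and f y but p^(t+1) does not divide both.
-- Since p ∥ C, no solution has p ∣ x and p ∣ y (else p² ∣ C zⁿ and p ∣ z); this rules out t > r.
-- For t ≤ r write f = pᵗ g and x = pᵗ X. Then p^(2t) ∣ C zⁿ forces z = p^q Z with q = ⌈(2t-1)/n⌉,
-- and the equation becomes X² + g²B₀y² = C′ Zⁿ with p^(2t) C′ = C p^(qn), i.e. C′ = C p^r′ if
-- n ∤ 2t-1 and C′ = C/p if n ∣ 2t-1. The rescaling (x, y, z) ↦ (X, y, Z) commutes with the action
-- of ±1, hence is an equivalence of groupoids once it is a bijection on objects; its inverse keeps
-- triples primitive because p ∤ y. For t < r, p divides g and C′, hence X, which *ₚ⁰ forbids.

module Submission where

open import Defs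
open import Data.Nat as ℕ using (ℕ; zero; suc; _≤_; _<_; NonZero)
import Data.Nat.Properties as ℕ
open import Data.Nat.Divisibility as ℕD using ()
open import Data.Nat.DivMod using (_/_; _%_; m≡m%n+[m/n]*n; m%n<n; m/n*n≤m)
open import Data.Nat.Primality using (Prime; euclidsLemma; prime⇒irreducible; prime⇒nonZero; prime⇒nonTrivial)
open import Data.Nat.Coprimality using (Coprime; coprime-divisor)
open import Data.Integer using (ℤ; +_; -[1+_]; _*_; _+_; _-_; _^_; 0ℤ; 1ℤ; ∣_∣)
import Data.Integer as ℤ
import Data.Integer.Properties as ℤ
open import Data.Integer.DivMod using (_%ℕ_)
import Data.Integer.Divisibility as Unsigned
open import Data.Integer.GCD using (gcd; gcd[i,j]∣i; gcd[i,j]∣j; gcd-greatest)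
open import Data.Integer.Tactic.RingSolver using (solve-∀)
import Data.Sign as Sign
open import Data.Product using (Σ; _×_; _,_; proj₁; proj₂)
open import Data.Sum using (_⊎_; inj₁; inj₂; reduce)
open import Data.Empty using (⊥; ⊥-elim)
open import Function.Base using (_∘_)
open import Function.Bundles using (_⇔_; mk⇔; Equivalence)
open import Function.Construct.Composition using (_⇔-∘_)
open import Function.Construct.Symmetry using (⇔-sym)
open import Function.Related.TypeIsomorphisms using (¬-cong-⇔)
open import Data.Product.Function.NonDependent.Propositional using (_×-⇔_)
open import Relation.Nullary using (¬_; yes; no)
open import Relation.Binary.PropositionalEquality

open Equivalence using (to; from)

n*[1+k]<n+m⇒n*k<m : ∀ n k m → n ℕ.* suc k < n ℕ.+ m → n ℕ.* k < m
n*[1+k]<n+m⇒n*k<m n k m bound = ℕ.+-cancelˡ-< n (n ℕ.* k) m (subst (_< n ℕ.+ m) (ℕ.*-suc n k) bound)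

⌈_/_⌉ : ℕ → (n : ℕ) .{{_ : NonZero n}} → ℕ
⌈ m / n ⌉ = (m ℕ.+ n ℕ.∸ 1) / n

n*⌈m/n⌉<n+m : ∀ m n .{{_ : NonZero n}} → n ℕ.* ⌈ m / n ⌉ < n ℕ.+ m
n*⌈m/n⌉<n+m m n@(suc n₁) = begin-strict
  n ℕ.* ⌈ m / n ⌉  ≡⟨ ℕ.*-comm n ⌈ m / n ⌉ ⟩
  ⌈ m / n ⌉ ℕ.* n  ≤⟨ m/n*n≤m (m ℕ.+ n ℕ.∸ 1) n ⟩
  m ℕ.+ n ℕ.∸ 1    ≡⟨ cong ℕ.pred (ℕ.+-suc m n₁) ⟩
  m ℕ.+ n₁         <⟨ ℕ.+-monoʳ-< m (ℕ.n<1+n n₁) ⟩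
  m ℕ.+ n          ≡⟨ ℕ.+-comm m n ⟩
  n ℕ.+ m          ∎
  where open ℕ.≤-Reasoning

m<⌈m/n⌉*n : ∀ m n .{{_ : NonZero n}} → ¬ (n ℕD.∣ m) → m < ⌈ m / n ⌉ ℕ.* n
m<⌈m/n⌉*n m n@(suc n₁) n∤m = ℕ.≤∧≢⇒< m≤qn (λ m≡qn → n∤m (ℕD.divides q m≡qn))
  where
  q N : ℕ
  q = ⌈ m / n ⌉
  N = m ℕ.+ n ℕ.∸ 1
  m≤qn : m ≤ q ℕ.* n
  m≤qn = ℕ.+-cancelʳ-≤ n₁ m (q ℕ.* n) (begin
    m ℕ.+ n₁           ≡⟨ cong ℕ.pred (ℕ.+-suc m n₁) ⟨
    N                  ≡⟨ m≡m%n+[m/n]*n N n ⟩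
    N % n ℕ.+ q ℕ.* n  ≤⟨ ℕ.+-monoˡ-≤ (q ℕ.* n) (ℕ.s≤s⁻¹ (m%n<n N n)) ⟩
    n₁ ℕ.+ q ℕ.* n     ≡⟨ ℕ.+-comm n₁ (q ℕ.* n) ⟩
    q ℕ.* n ℕ.+ n₁     ∎)
    where open ℕ.≤-Reasoning

⌈[2t∸1]/n⌉*n≡2t+r′ : ∀ n t .{{_ : NonZero n}} → ¬ (n ℕD.∣ 2 ℕ.* t ℕ.∸ 1) →
                     ⌈ 2 ℕ.* t ℕ.∸ 1 / n ⌉ ℕ.* n ≡ 2 ℕ.* t ℕ.+ r′ n t
⌈[2t∸1]/n⌉*n≡2t+r′ n@(suc _) t n∤2t∸1 =
  sym (ℕ.m+[n∸m]≡n (ℕ.≤-trans (ℕ.m≤n+m∸n (2 ℕ.* t) 1) (m<⌈m/n⌉*n _ n n∤2t∸1)))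

^-distrib-* : ∀ x y n → (x * y) ^ n ≡ x ^ n * y ^ n
^-distrib-* x y zero    = refl
^-distrib-* x y (suc n) = trans (cong (x * y *_) (^-distrib-* x y n)) (interchange x y (x ^ n) (y ^ n))
  where
  interchange : ∀ a b c d → a * b * (c * d) ≡ a * c * (b * d)
  interchange = solve-∀

a^[2t]*[C*a^r′]≡C*a^[qn] : ∀ a C n t .{{_ : NonZero n}} → ¬ (n ℕD.∣ 2 ℕ.* t ℕ.∸ 1) →
                          a ^ (2 ℕ.* t) * (C * a ^ r′ n t) ≡ C * a ^ (⌈ 2 ℕ.* t ℕ.∸ 1 / n ⌉ ℕ.* n)
a^[2t]*[C*a^r′]≡C*a^[qn] a C n t n∤2t∸1 = begin
  a ^ (2 ℕ.* t) * (C * a ^ r′ n t)       ≡⟨ swap (a ^ (2 ℕ.* t)) C (a ^ r′ n t) ⟩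
  C * (a ^ (2 ℕ.* t) * a ^ r′ n t)       ≡⟨ cong (C *_) (ℤ.^-distribˡ-+-* a (2 ℕ.* t) (r′ n t)) ⟨
  C * a ^ (2 ℕ.* t ℕ.+ r′ n t)           ≡⟨ cong (λ k → C * a ^ k) (⌈[2t∸1]/n⌉*n≡2t+r′ n t n∤2t∸1) ⟨
  C * a ^ (⌈ 2 ℕ.* t ℕ.∸ 1 / n ⌉ ℕ.* n)  ∎
  where
  open ≡-Reasoning
  swap : ∀ a b c → a * (b * c) ≡ b * (a * c)
  swap = solve-∀

a^[2t]*C₀≡a*C₀*a^[qn] : ∀ a C₀ t q n .{{_ : NonZero t}} → 2 ℕ.* t ℕ.∸ 1 ≡ q ℕ.* n →
                       a ^ (2 ℕ.* t) * C₀ ≡ a * C₀ * a ^ (q ℕ.* n)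
a^[2t]*C₀≡a*C₀*a^[qn] a C₀ t q n 2t∸1≡qn = begin
  a ^ (2 ℕ.* t) * C₀            ≡⟨ cong (λ k → a ^ k * C₀) (ℕ.suc-pred (2 ℕ.* t) {{ℕ.m*n≢0 2 t}}) ⟨
  a * a ^ (2 ℕ.* t ℕ.∸ 1) * C₀  ≡⟨ swap a (a ^ (2 ℕ.* t ℕ.∸ 1)) C₀ ⟩
  a * C₀ * a ^ (2 ℕ.* t ℕ.∸ 1)  ≡⟨ cong (λ k → a * C₀ * a ^ k) 2t∸1≡qn ⟩
  a * C₀ * a ^ (q ℕ.* n)        ∎
  where
  open ≡-Reasoning
  swap : ∀ a b c → a * b * c ≡ a * c * b
  swap = solve-∀

Scales : ℤ → ℤ → Triple → Triple → Set
Scales c₁ c₂ (x , y , z) (X , Y , Z) = x ≡ X * c₁ × y ≡ Y × z ≡ Z * c₂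

*-scale-≡ : ∀ c .{{_ : ℤ.NonZero c}} k X Y → k * (X * c) ≡ Y * c ⇔ k * X ≡ Y
*-scale-≡ c k X Y = mk⇔
  (λ e → ℤ.*-cancelʳ-≡ (k * X) Y c (trans (ℤ.*-assoc k X c) e))
  (λ e → trans (sym (ℤ.*-assoc k X c)) (cong (_* c) e))

module _ {c₁ c₂ : ℤ} .{{_ : ℤ.NonZero c₁}} .{{_ : ℤ.NonZero c₂}} where

  act-Scales : ∀ n s {u U v V} → Scales c₁ c₂ u U → Scales c₁ c₂ v V →
               act n s u ≡ v ⇔ act n s U ≡ V
  act-Scales n s {_ , _ , _} {X , Y , Z} {_ , _ , _} {X′ , Y′ , Z′} (refl , refl , refl) (refl , refl , refl) =
    mk⇔ (λ e → cong₃ (to (*-scale-≡ c₁ (σ s ^ n) X X′) (cong proj₁ e))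
                     (cong (proj₁ ∘ proj₂) e)
                     (to (*-scale-≡ c₂ (σ s ^ 2) Z Z′) (cong (proj₂ ∘ proj₂) e)))
        (λ e → cong₃ (from (*-scale-≡ c₁ (σ s ^ n) X X′) (cong proj₁ e))
                     (cong (proj₁ ∘ proj₂) e)
                     (from (*-scale-≡ c₂ (σ s ^ 2) Z Z′) (cong (proj₂ ∘ proj₂) e)))
    where
    cong₃ : ∀ {a b c a′ b′ c′ : ℤ} → a ≡ a′ → b ≡ b′ → c ≡ c′ → (a , b , c) ≡ (a′ , b′ , c′)
    cong₃ refl refl refl = refl

  scalingEquiv : ∀ {n B₁ C₁ P₁ B₂ C₂ P₂} →
    (down : (a : Obj n B₁ C₁ P₁) → Σ (Obj n B₂ C₂ P₂) λ b → Scales c₁ c₂ (triple a) (triple b)) →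
    (up : (b : Obj n B₂ C₂ P₂) → Σ (Obj n B₁ C₁ P₁) λ a → Scales c₁ c₂ (triple a) (triple b)) →
    Equiv n B₁ C₁ P₁ B₂ C₂ P₂
  scalingEquiv {n} {B₁} {C₁} {P₁} {B₂} {C₂} {P₂} down up = record
    { F₀       = F₀
    ; F₁       = λ {a} {b} (hom s e) → hom s (to (act-Scales n s (scales a) (scales b)) e)
    ; F-id     = λ _ → refl
    ; F-∘      = λ _ _ → refl
    ; full     = λ {a} {b} (hom s e) → hom s (from (act-Scales n s (scales a) (scales b)) e) , refl
    ; faithful = λ _ _ e → e
    ; esssurj  = λ b → let (a , a~b) = up b in
                       a , hom Sign.+ (to (act-Scales n Sign.+ (scales a) a~b) (act-id n (triple a)))
    }
    where
    F₀ : Obj n B₁ C₁ P₁ → Obj n B₂ C₂ P₂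
    F₀ a = proj₁ (down a)
    scales : (a : Obj n B₁ C₁ P₁) → Scales c₁ c₂ (triple a) (triple (F₀ a))
    scales a = proj₂ (down a)

-- Signed divisibility from here on; the statement of lemma6p6 uses the unsigned one
module _ where
  open import Data.Integer.Divisibility.Signed

  Solves : ℕ → ℤ → ℤ → ℤ → ℤ → ℤ → Set
  Solves n B C x y z = x * x + B * (y * y) ≡ C * z ^ n

  Primitive : ℤ → ℤ → ℤ → Set
  Primitive x y z = gcd (gcd x y) z ≡ + 1

  common-divisor⇒∣d∣≡1 : ∀ {x y z d} → Primitive x y z → d ∣ x → d ∣ y → d ∣ z → ∣ d ∣ ≡ 1
  common-divisor⇒∣d∣≡1 {x} {y} {z} {d} prim d∣x d∣y d∣z = ℕD.∣1⇒≡1 (subst (λ g → ∣ d ∣ ℕD.∣ ∣ g ∣) prim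
    (gcd-greatest {gcd x y} {z} {d} (gcd-greatest {x} {y} {d} (∣⇒∣ᵤ d∣x) (∣⇒∣ᵤ d∣y)) (∣⇒∣ᵤ d∣z)))

  primitive-by : ∀ {x y z} → (∀ {d} → d ∣ x → d ∣ y → d ∣ z → ∣ d ∣ ≡ 1) → Primitive x y z
  primitive-by {x} {y} {z} unit = cong +_ (unit
    (∣-trans (gcd∣ˡ (gcd x y) z) (gcd∣ˡ x y))
    (∣-trans (gcd∣ˡ (gcd x y) z) (gcd∣ʳ x y))
    (gcd∣ʳ (gcd x y) z))
    where
    gcd∣ˡ : ∀ i j → gcd i j ∣ i
    gcd∣ˡ i j = ∣ᵤ⇒∣ (gcd[i,j]∣i i j)
    gcd∣ʳ : ∀ i j → gcd i j ∣ j
    gcd∣ʳ i j = ∣ᵤ⇒∣ (gcd[i,j]∣j i j)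

  primitive-unscale : ∀ {X y Z c₁ c₂} → Primitive (X * c₁) y (Z * c₂) → Primitive X y Z
  primitive-unscale {X} {y} {Z} {c₁} {c₂} prim = primitive-by {X} {y} {Z} λ {d} d∣X d∣y d∣Z →
    common-divisor⇒∣d∣≡1 {d = d} prim (∣m⇒∣m*n c₁ d∣X) d∣y (∣m⇒∣m*n c₂ d∣Z)

  module _ {p : ℕ} (p-prime : Prime p) where

    private
      P : ℤ
      P = + p

      instance
        p≢0 : ℤ.NonZero P
        p≢0 = prime⇒nonZero p-prime

    p^k≢0 : ∀ k → ℤ.NonZero (P ^ k)
    p^k≢0 zero    = record { nonZero = _ }
    p^k≢0 (suc k) = ℤ.i*j≢0 P (P ^ k) {{p≢0}} {{p^k≢0 k}}

    p≢1 : p ≢ 1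
    p≢1 = ℕ.>⇒≢ (ℕ.nonTrivial⇒n>1 p {{prime⇒nonTrivial p-prime}})

    p∤1 : ¬ P ∣ 1ℤ
    p∤1 p∣1 = p≢1 (ℕD.∣1⇒≡1 (∣⇒∣ᵤ p∣1))

    p∣xy⇒p∣x⊎p∣y : ∀ {x y} → P ∣ x * y → (P ∣ x) ⊎ (P ∣ y)
    p∣xy⇒p∣x⊎p∣y {x} {y} p∣xy with euclidsLemma ∣ x ∣ ∣ y ∣ p-prime (subst (p ℕD.∣_) (ℤ.abs-* x y) (∣⇒∣ᵤ p∣xy))
    ... | inj₁ p∣x = inj₁ (∣ᵤ⇒∣ p∣x)
    ... | inj₂ p∣y = inj₂ (∣ᵤ⇒∣ p∣y)

    p∣x*x⇒p∣x : ∀ {x} → P ∣ x * x → P ∣ x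
    p∣x*x⇒p∣x p∣xx = reduce (p∣xy⇒p∣x⊎p∣y p∣xx)

    p∣xⁿ⇒p∣x : ∀ n {x} → P ∣ x ^ n → P ∣ x
    p∣xⁿ⇒p∣x zero    p∣1  = ⊥-elim (p∤1 p∣1)
    p∣xⁿ⇒p∣x (suc n) p∣xⁿ with p∣xy⇒p∣x⊎p∣y p∣xⁿ
    ... | inj₁ p∣x    = p∣x
    ... | inj₂ p∣xⁿ⁻¹ = p∣xⁿ⇒p∣x n p∣xⁿ⁻¹

    p∤d⇒coprime : ∀ {d} → ¬ P ∣ d → Coprime ∣ d ∣ p
    p∤d⇒coprime p∤d (e∣d , e∣p) with prime⇒irreducible p-prime e∣p
    ... | inj₁ e≡1  = e≡1
    ... | inj₂ refl = ⊥-elim (p∤d (∣ᵤ⇒∣ e∣d))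

    p^0∣x : ∀ {x} → P ^ 0 ∣ x
    p^0∣x {x} = divides x (sym (ℤ.*-identityʳ x))

    p^k∣xy⇒p^k∣x : ∀ k {x y} → ¬ P ∣ y → P ^ k ∣ x * y → P ^ k ∣ x
    p^k∣xy⇒p^k∣x zero    _   _ = p^0∣x
    p^k∣xy⇒p^k∣x (suc k) {x} {y} p∤y p^[1+k]∣xy with p∣xy⇒p∣x⊎p∣y {x} {y} (∣-trans (∣m⇒∣m*n (P ^ k) ∣-refl) p^[1+k]∣xy)
    ... | inj₂ p∣y = ⊥-elim (p∤y p∣y)
    ... | inj₁ (divides w refl) =
      subst (_∣ w * P) (ℤ.*-comm (P ^ k) P) (*-monoˡ-∣ P {P ^ k} {w}
        (p^k∣xy⇒p^k∣x k p∤y (*-cancelʳ-∣ P (subst₂ _∣_ (ℤ.*-comm P (P ^ k)) (shuffle w P y) p^[1+k]∣xy))))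
      where
      shuffle : ∀ w P y → w * P * y ≡ w * y * P
      shuffle = solve-∀

    p∣x⇒p^1∣x : ∀ {x} → P ∣ x → P ^ 1 ∣ x
    p∣x⇒p^1∣x {x} = subst (_∣ x) (sym (ℤ.^-identityʳ P))

    p^[1+k]∣x⇒p∣x : ∀ k {x} → P ^ suc k ∣ x → P ∣ x
    p^[1+k]∣x⇒p∣x k = ∣-trans (∣m⇒∣m*n (P ^ k) ∣-refl)

    p^k∣x⇒p^[1+k]∣x*p : ∀ k {x} → P ^ k ∣ x → P ^ suc k ∣ x * P
    p^k∣x⇒p^[1+k]∣x*p k {x} p^k∣x = subst (_∣ x * P) (ℤ.*-comm (P ^ k) P) (*-monoˡ-∣ P p^k∣x)

    p∣x⇒p²∣x*x : ∀ {x} → P ∣ x → P ^ 2 ∣ x * x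
    p∣x⇒p²∣x*x (divides a refl) = divides (a * a) (square a P)
      where
      square : ∀ a P → a * P * (a * P) ≡ a * a * (P * (P * 1ℤ))
      square = solve-∀

    p^k∣p^m : ∀ {k m} → k ≤ m → P ^ k ∣ P ^ m
    p^k∣p^m {k} {m} k≤m = divides (P ^ (m ℕ.∸ k)) (begin
      P ^ m                    ≡⟨ cong (P ^_) (ℕ.m+[n∸m]≡n k≤m) ⟨
      P ^ (k ℕ.+ (m ℕ.∸ k))    ≡⟨ ℤ.^-distribˡ-+-* P k (m ℕ.∸ k) ⟩
      P ^ k * P ^ (m ℕ.∸ k)    ≡⟨ ℤ.*-comm (P ^ k) (P ^ (m ℕ.∸ k)) ⟩
      P ^ (m ℕ.∸ k) * P ^ k    ∎)
      where open ≡-Reasoning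

    p^m∣x*p^n⇒p^[m∸n]∣x : ∀ m n {x} → P ^ m ∣ x * P ^ n → P ^ (m ℕ.∸ n) ∣ x
    p^m∣x*p^n⇒p^[m∸n]∣x m n {x} p^m∣xpⁿ with ℕ.≤-total m n
    ... | inj₁ m≤n rewrite ℕ.m≤n⇒m∸n≡0 m≤n = p^0∣x
    ... | inj₂ n≤m = *-cancelʳ-∣ (P ^ n) {{p^k≢0 n}} (subst (_∣ x * P ^ n) p^m≡ p^m∣xpⁿ)
      where
      p^m≡ : P ^ m ≡ P ^ (m ℕ.∸ n) * P ^ n
      p^m≡ = trans (cong (P ^_) (sym (ℕ.m∸n+n≡m n≤m))) (ℤ.^-distribˡ-+-* P (m ℕ.∸ n) n)

    -- n * k < n + m means k ≤ ⌈m/n⌉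
    p^m∣zⁿ⇒p^k∣z : ∀ n k m {z} → n ℕ.* k < n ℕ.+ m → P ^ m ∣ z ^ n → P ^ k ∣ z
    p^m∣zⁿ⇒p^k∣z n zero    m _ _ = p^0∣x
    p^m∣zⁿ⇒p^k∣z n (suc k) m {z} bound p^m∣zⁿ
      with p∣xⁿ⇒p∣x n (p^[1+k]∣x⇒p∣x (n ℕ.* k) (∣-trans (p^k∣p^m (n*[1+k]<n+m⇒n*k<m n k m bound)) p^m∣zⁿ))
    ... | divides w refl = p^k∣x⇒p^[1+k]∣x*p k (p^m∣zⁿ⇒p^k∣z n k (m ℕ.∸ n) bound′
            (p^m∣x*p^n⇒p^[m∸n]∣x m n (subst (P ^ m ∣_) (^-distrib-* w P n) p^m∣zⁿ)))
      where
      bound′ : n ℕ.* k < n ℕ.+ (m ℕ.∸ n)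
      bound′ = ℕ.≤-trans (n*[1+k]<n+m⇒n*k<m n k m bound) (ℕ.m≤n+m∸n m n)

    p^m∣C*w⇒p^[m∸1]∣w : ∀ m {C C₀ w} → C ≡ P * C₀ → ¬ P ∣ C₀ → P ^ m ∣ C * w → P ^ (m ℕ.∸ 1) ∣ w
    p^m∣C*w⇒p^[m∸1]∣w m {C₀ = C₀} {w} refl p∤C₀ p^m∣Cw =
      p^k∣xy⇒p^k∣x (m ℕ.∸ 1) p∤C₀ (p^m∣x*p^n⇒p^[m∸n]∣x m 1 (subst (P ^ m ∣_) (shuffle P C₀ w) p^m∣Cw))
      where
      shuffle : ∀ P C₀ w → P * C₀ * w ≡ w * C₀ * (P * 1ℤ)
      shuffle = solve-∀

    -- p² ∣ x² + B y² = C zⁿ with p ∥ C forces p ∣ z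
    ¬p∣x×p∣y : ∀ {n B C C₀ Q} → C ≡ P * C₀ → ¬ P ∣ C₀ → (a : Obj n B C Q) → P ∣ x a → P ∣ y a → ⊥
    ¬p∣x×p∣y {n} {B} {C} C≡pC₀ p∤C₀ (sol x y z solves prim _) p∣x p∣y =
      p≢1 (common-divisor⇒∣d∣≡1 {x} {y} {z} prim p∣x p∣y p∣z)
      where
      p²∣Czⁿ : P ^ 2 ∣ C * z ^ n
      p²∣Czⁿ = subst (P ^ 2 ∣_) solves (∣m∣n⇒∣m+n (p∣x⇒p²∣x*x p∣x) (∣n⇒∣m*n B (p∣x⇒p²∣x*x p∣y)))
      p∣z : P ∣ z
      p∣z = p∣xⁿ⇒p∣x n (p^[1+k]∣x⇒p∣x 0 (p^m∣C*w⇒p^[m∸1]∣w 2 C≡pC₀ p∤C₀ p²∣Czⁿ))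

    InPow : ℕ → ℤ → ℤ → ℤ → Set
    InPow s f x y = (P ^ s ∣ x) × (P ^ s ∣ f * y)

    p^[s+t]∣x*p^t⇔p^s∣x : ∀ s t {x} → (P ^ (s ℕ.+ t) ∣ x * P ^ t) ⇔ (P ^ s ∣ x)
    p^[s+t]∣x*p^t⇔p^s∣x s t {x} = mk⇔
      (λ d → *-cancelʳ-∣ (P ^ t) {{p^k≢0 t}} (subst (_∣ x * P ^ t) (ℤ.^-distribˡ-+-* P s t) d))
      (λ d → subst (_∣ x * P ^ t) (sym (ℤ.^-distribˡ-+-* P s t)) (*-monoˡ-∣ (P ^ t) d))

    InPow-scale : ∀ s t {g X y} → InPow (s ℕ.+ t) (P ^ t * g) (X * P ^ t) y ⇔ InPow s g X y
    InPow-scale s t {g} {X} {y} = mk⇔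
      (λ (p∣x , p∣fy) → to (p^[s+t]∣x*p^t⇔p^s∣x s t) p∣x ,
                        to (p^[s+t]∣x*p^t⇔p^s∣x s t) (subst (_ ∣_) (shuffle (P ^ t) g y) p∣fy))
      (λ (p∣X , p∣gy) → from (p^[s+t]∣x*p^t⇔p^s∣x s t) p∣X ,
                        subst (_ ∣_) (sym (shuffle (P ^ t) g y)) (from (p^[s+t]∣x*p^t⇔p^s∣x s t) p∣gy))
      where
      shuffle : ∀ Q g y → Q * g * y ≡ g * y * Q
      shuffle = solve-∀

    d∣x*p^a⇒d∣x : ∀ a {d x} → ¬ P ∣ d → d ∣ x * P ^ a → d ∣ x
    d∣x*p^a⇒d∣x zero    {d} {x} _   d∣x*1 = subst (d ∣_) (ℤ.*-identityʳ x) d∣x*1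
    d∣x*p^a⇒d∣x (suc a) {d} {x} p∤d d∣x*p^[1+a] = d∣x*p^a⇒d∣x a p∤d (∣ᵤ⇒∣ (coprime-divisor (p∤d⇒coprime p∤d)
      (subst (∣ d ∣ ℕD.∣_) (ℤ.abs-* P (x * P ^ a)) (∣⇒∣ᵤ (subst (d ∣_) (shuffle x P (P ^ a)) d∣x*p^[1+a])))))
      where
      shuffle : ∀ x P Q → x * (P * Q) ≡ P * (x * Q)
      shuffle = solve-∀

    primitive-scale : ∀ a b {X y Z} → Primitive X y Z → ¬ P ∣ y → Primitive (X * P ^ a) y (Z * P ^ b)
    primitive-scale a b {X} {y} {Z} prim p∤y = primitive-by {X * P ^ a} {y} {Z * P ^ b} λ d∣X′ d∣y d∣Z′ →
      let p∤d = λ p∣d → p∤y (∣-trans p∣d d∣y) in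
      common-divisor⇒∣d∣≡1 {X} {y} {Z} prim (d∣x*p^a⇒d∣x a p∤d d∣X′) d∣y (d∣x*p^a⇒d∣x b p∤d d∣Z′)

    p^1∥C⇒C≡pC₀ : ∀ {C} → p ^ 1 ∥ C → Σ ℤ λ C₀ → C ≡ P * C₀
    p^1∥C⇒C≡pC₀ {C} (p∣C , _) with ∣ᵤ⇒∣ {P ^ 1} {C} p∣C
    ... | divides C₀ refl = C₀ , trans (ℤ.*-comm C₀ (P ^ 1)) (cong (_* C₀) (ℤ.^-identityʳ P))

    p^1∥C⇒p∤C₀ : ∀ {C C₀} → p ^ 1 ∥ C → C ≡ P * C₀ → ¬ P ∣ C₀
    p^1∥C⇒p∤C₀ (_ , p²∤C) refl (divides w refl) = p²∤C (∣⇒∣ᵤ (divides w (shuffle P w)))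
      where
      shuffle : ∀ P w → P * (w * P) ≡ w * (P * (P * 1ℤ))
      shuffle = solve-∀

    𝒴* : ℕ → ℤ → ℤ → ℤ → ℕ → Set
    𝒴* n B₀ f C t = Obj n (f * f * B₀) C (λ x y _ → Star p t B₀ f x y)

    C≡pC₀⇒p∣C : ∀ {C C₀} → C ≡ P * C₀ → P ∣ C
    C≡pC₀⇒p∣C {C₀ = C₀} refl = divides C₀ (ℤ.*-comm P C₀)

    module _ (p≢2 : p ≢ 2) where

      p∤2 : ¬ P ∣ + 2
      p∤2 p∣2 = p≢2 (ℕ.≤-antisym (ℕD.∣⇒≤ (∣⇒∣ᵤ p∣2)) (ℕ.nonTrivial⇒n>1 p {{prime⇒nonTrivial p-prime}}))

      -- p is odd
      InPowOK⇔InPow : ∀ s {B₀ f x y} → InPowOK p s B₀ f x y ⇔ InPow s f x y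
      InPowOK⇔InPow s {B₀} {f} {x} {y} = mk⇔ to′ from′
        where
        halve : ∀ {u a} → + 2 * u ≡ P ^ s * a → P ^ s ∣ u
        halve {u} {a} 2u≡ = p^k∣xy⇒p^k∣x s p∤2 (divides a (trans (ℤ.*-comm u (+ 2)) (trans 2u≡ (ℤ.*-comm (P ^ s) a))))

        double : ∀ {u U} → u ≡ U * P ^ s → + 2 * u ≡ P ^ s * (+ 2 * U)
        double {U = U} refl = rearrange U (P ^ s)
          where
          rearrange : ∀ U Q → + 2 * (U * Q) ≡ Q * (+ 2 * U)
          rearrange = solve-∀

        to′ : InPowOK p s B₀ f x y → InPow s f x y
        to′ (inj₁ (_ , _ , _ , 2x≡ , 2fy≡ , _)) = halve 2x≡ , halve 2fy≡
        to′ (inj₂ (_ , a , b , x≡ , fy≡))       =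
          divides a (trans x≡ (ℤ.*-comm (P ^ s) a)) , divides b (trans fy≡ (ℤ.*-comm (P ^ s) b))

        from′ : InPow s f x y → InPowOK p s B₀ f x y
        from′ (divides X x≡ , divides Y fy≡) with (ℤ.- B₀) %ℕ 4 ℕ.≟ 1
        ... | yes ≡1 = inj₁ (≡1 , + 2 * X , + 2 * Y , double x≡ , double fy≡ ,
                             ∣⇒∣ᵤ (divides (X - Y) (factor X Y)))
          where
          factor : ∀ X Y → + 2 * X - + 2 * Y ≡ (X - Y) * + 2
          factor = solve-∀
        ... | no ≢1  = inj₂ (≢1 , X , Y , trans x≡ (ℤ.*-comm X (P ^ s)) , trans fy≡ (ℤ.*-comm Y (P ^ s)))

      Star⇔ : ∀ s {B₀ f x y} → Star p s B₀ f x y ⇔ (InPow s f x y × ¬ InPow (suc s) f x y)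
      Star⇔ s {B₀} {f} {x} {y} =
        InPowOK⇔InPow s {B₀} {f} {x} {y} ×-⇔ ¬-cong-⇔ (InPowOK⇔InPow (suc s) {B₀} {f} {x} {y})

      Star-scale : ∀ t {B₀ g X y} → Star p t B₀ (P ^ t * g) (X * P ^ t) y ⇔ Star p 0 B₀ g X y
      Star-scale t {B₀} {g} {X} {y} =
        ⇔-sym (Star⇔ 0 {B₀} {g} {X} {y})
          ⇔-∘ ((InPow-scale 0 t ×-⇔ ¬-cong-⇔ (InPow-scale 1 t)) ⇔-∘ Star⇔ t {B₀} {P ^ t * g} {X * P ^ t} {y})

      p∣C⇒p∤gy : ∀ {n B₀ g C} → P ∣ C → (b : 𝒴* n B₀ g C 0) → ¬ P ∣ g * y b
      p∣C⇒p∤gy {n} {B₀} {g} p∣C (sol X y Z solves _ st) p∣gy =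
        proj₂ (to (Star⇔ 0 {B₀} {g} {X} {y}) st) (p∣x⇒p^1∣x p∣X , p∣x⇒p^1∣x p∣gy)
        where
        rearrange : ∀ g y B₀ → B₀ * (g * y * (g * y)) ≡ g * g * B₀ * (y * y)
        rearrange = solve-∀
        p∣g²B₀y² : P ∣ g * g * B₀ * (y * y)
        p∣g²B₀y² = subst (P ∣_) (rearrange g y B₀) (∣n⇒∣m*n B₀ (∣m⇒∣m*n (g * y) p∣gy))
        p∣X : P ∣ X
        p∣X = p∣x*x⇒p∣x (∣m+n∣n⇒∣m (subst (P ∣_) (sym solves) (∣m⇒∣m*n (Z ^ n) p∣C)) p∣g²B₀y²)

      -- (x, y, z) = (X pᵗ, y, Z p^q) between 𝒴*(pᵗ g, C, t) and 𝒴*(g, C′, 0); the bound on q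
      -- guarantees p^q ∣ z, and p ∤ y is needed only to keep the ascended triple primitive
      module Rescaling {n t q : ℕ} {B₀ g C C₀ C′ : ℤ}
        (C≡pC₀ : C ≡ P * C₀) (p∤C₀ : ¬ P ∣ C₀)
        (C′-scaled : P ^ (2 ℕ.* t) * C′ ≡ C * P ^ (q ℕ.* n))
        (q-bound : n ℕ.* q < n ℕ.+ (2 ℕ.* t ℕ.∸ 1)) where

        p^t*p^t≡p^[2t] : P ^ t * P ^ t ≡ P ^ (2 ℕ.* t)
        p^t*p^t≡p^[2t] = trans (sym (ℤ.^-distribˡ-+-* P t t)) (cong (λ k → P ^ (t ℕ.+ k)) (sym (ℕ.+-identityʳ t)))

        lhs-scaled : ∀ X y → X * P ^ t * (X * P ^ t) + P ^ t * g * (P ^ t * g) * B₀ * (y * y)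
                             ≡ (X * X + g * g * B₀ * (y * y)) * P ^ (2 ℕ.* t)
        lhs-scaled X y = trans (factor X (P ^ t) g B₀ y) (cong ((X * X + g * g * B₀ * (y * y)) *_) p^t*p^t≡p^[2t])
          where
          factor : ∀ X Q g B₀ y → X * Q * (X * Q) + Q * g * (Q * g) * B₀ * (y * y)
                                  ≡ (X * X + g * g * B₀ * (y * y)) * (Q * Q)
          factor = solve-∀

        rhs-scaled : ∀ Z → C * (Z * P ^ q) ^ n ≡ C′ * Z ^ n * P ^ (2 ℕ.* t)
        rhs-scaled Z = begin
          C * (Z * P ^ q) ^ n          ≡⟨ cong (C *_) (^-distrib-* Z (P ^ q) n) ⟩
          C * (Z ^ n * (P ^ q) ^ n)    ≡⟨ cong (λ w → C * (Z ^ n * w)) (ℤ.^-*-assoc P q n) ⟩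
          C * (Z ^ n * P ^ (q ℕ.* n))  ≡⟨ swap C (Z ^ n) (P ^ (q ℕ.* n)) ⟩
          C * P ^ (q ℕ.* n) * Z ^ n    ≡⟨ cong (_* Z ^ n) C′-scaled ⟨
          P ^ (2 ℕ.* t) * C′ * Z ^ n   ≡⟨ rotate (P ^ (2 ℕ.* t)) C′ (Z ^ n) ⟩
          C′ * Z ^ n * P ^ (2 ℕ.* t)   ∎
          where
          open ≡-Reasoning
          swap : ∀ a b c → a * (b * c) ≡ a * c * b
          swap = solve-∀
          rotate : ∀ a b c → a * b * c ≡ b * c * a
          rotate = solve-∀

        Solves-scale : ∀ {X y Z} → Solves n (P ^ t * g * (P ^ t * g) * B₀) C (X * P ^ t) y (Z * P ^ q)
                                 ⇔ Solves n (g * g * B₀) C′ X y Z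
        Solves-scale {X} {y} {Z} = mk⇔
          (λ e → ℤ.*-cancelʳ-≡ (X * X + g * g * B₀ * (y * y)) (C′ * Z ^ n) (P ^ (2 ℕ.* t)) {{p^k≢0 (2 ℕ.* t)}}
                   (trans (sym (lhs-scaled X y)) (trans e (rhs-scaled Z))))
          (λ e → trans (lhs-scaled X y) (trans (cong (_* P ^ (2 ℕ.* t)) e) (sym (rhs-scaled Z))))

        p^q∣z : ∀ {X y z} → Solves n (P ^ t * g * (P ^ t * g) * B₀) C (X * P ^ t) y z → P ^ q ∣ z
        p^q∣z {X} {y} {z} solves = p^m∣zⁿ⇒p^k∣z n q (2 ℕ.* t ℕ.∸ 1) q-bound
          (p^m∣C*w⇒p^[m∸1]∣w (2 ℕ.* t) C≡pC₀ p∤C₀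
            (divides (X * X + g * g * B₀ * (y * y)) (trans (sym solves) (lhs-scaled X y))))

        descend : (a : 𝒴* n B₀ (P ^ t * g) C t) →
                  Σ (𝒴* n B₀ g C′ 0) λ b → Scales (P ^ t) (P ^ q) (triple a) (triple b)
        descend (sol x y z solves prim st) with proj₁ (proj₁ (to (Star⇔ t {B₀} {P ^ t * g} {x} {y}) st))
        ... | divides X refl with p^q∣z {X} {y} {z} solves
        ...   | divides Z refl =
          sol X y Z (to (Solves-scale {X} {y} {Z}) solves) (primitive-unscale {X} {y} {Z} prim)
              (to (Star-scale t {B₀} {g} {X} {y}) st) ,
          refl , refl , refl

        ascend : (b : 𝒴* n B₀ g C′ 0) → ¬ P ∣ y b →
                 Σ (𝒴* n B₀ (P ^ t * g) C t) λ a → Scales (P ^ t) (P ^ q) (triple a) (triple b)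
        ascend (sol X y Z solves prim st) p∤y =
          sol (X * P ^ t) y (Z * P ^ q) (from (Solves-scale {X} {y} {Z}) solves)
              (primitive-scale t q {X} {y} {Z} prim p∤y) (from (Star-scale t {B₀} {g} {X} {y}) st) ,
          refl , refl , refl

      module Rescalingʳ′ {n t B₀ g C C₀} .{{_ : NonZero n}} (C≡pC₀ : C ≡ P * C₀) (p∤C₀ : ¬ P ∣ C₀)
                         (n∤2t∸1 : ¬ (n ℕD.∣ 2 ℕ.* t ℕ.∸ 1)) =
        Rescaling {n} {t} {⌈ 2 ℕ.* t ℕ.∸ 1 / n ⌉} {B₀} {g} {C} {C₀} {C * P ^ r′ n t} C≡pC₀ p∤C₀
                  (a^[2t]*[C*a^r′]≡C*a^[qn] P C n t n∤2t∸1) (n*⌈m/n⌉<n+m (2 ℕ.* t ℕ.∸ 1) n)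

      t>r⇒𝒴*-empty : ∀ {n B₀ f C C₀ r t} → C ≡ P * C₀ → ¬ P ∣ C₀ → ¬ (P ^ suc r ∣ f) → r < t →
                     ¬ 𝒴* n B₀ f C t
      t>r⇒𝒴*-empty {B₀ = B₀} {f} {r = r} {t} C≡pC₀ p∤C₀ p^[1+r]∤f r<t a@(sol x y _ _ _ st)
        with to (Star⇔ t {B₀} {f} {x} {y}) st | P ∣? y
      ... | (p^t∣x , _) , _ | yes p∣y =
        ¬p∣x×p∣y C≡pC₀ p∤C₀ a (p^[1+k]∣x⇒p∣x r (∣-trans (p^k∣p^m r<t) p^t∣x)) p∣y
      ... | (_ , p^t∣fy) , _ | no p∤y = p^[1+r]∤f (∣-trans (p^k∣p^m r<t) (p^k∣xy⇒p^k∣x t p∤y p^t∣fy))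

      -- here p ∣ g = f / pᵗ and p ∣ C′ = C p^r′, so the descended solution violates *ₚ⁰
      t<r⇒𝒴*-empty : ∀ {n B₀ f C C₀ r t} .{{_ : NonZero n}} → C ≡ P * C₀ → ¬ P ∣ C₀ → P ^ r ∣ f → t < r →
                     ¬ (n ℕD.∣ 2 ℕ.* t ℕ.∸ 1) → ¬ 𝒴* n B₀ f C t
      t<r⇒𝒴*-empty {n} {B₀} {f} {C} {C₀} {r} {t} C≡pC₀ p∤C₀ p^r∣f t<r n∤2t∸1 a
        with ∣-trans (p^k∣p^m t<r) p^r∣f
      ... | divides G refl =
        p∣C⇒p∤gy {n} {B₀} {G * P} (∣m⇒∣m*n (P ^ r′ n t) (C≡pC₀⇒p∣C C≡pC₀)) b (∣m⇒∣m*n (y b) (∣n⇒∣m*n G ∣-refl))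
        where
        open Rescalingʳ′ {n} {t} {B₀} {G * P} C≡pC₀ p∤C₀ n∤2t∸1
        regroup : ∀ G P Q → G * (P * Q) ≡ Q * (G * P)
        regroup = solve-∀
        b : 𝒴* n B₀ (G * P) (C * P ^ r′ n t) 0
        b = proj₁ (descend (subst (λ f → 𝒴* n B₀ f C t) (regroup G P (P ^ t)) a))

      n∤2t∸1⇒𝒴*≃ : ∀ {n t B₀ f g C C₀} .{{_ : NonZero n}} → C ≡ P * C₀ → ¬ P ∣ C₀ →
                   ¬ (n ℕD.∣ 2 ℕ.* t ℕ.∸ 1) → f ≡ P ^ t * g →
                   Equiv n (f * f * B₀) C (λ x y z → Star p t B₀ f x y)
                           (g * g * B₀) (C * P ^ r′ n t) (λ x y z → Star p 0 B₀ g x y)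
      n∤2t∸1⇒𝒴*≃ {n} {t} {B₀} {g = g} {C} C≡pC₀ p∤C₀ n∤2t∸1 refl =
        scalingEquiv {{p^k≢0 t}} {{p^k≢0 ⌈ 2 ℕ.* t ℕ.∸ 1 / n ⌉}} descend λ b →
          ascend b λ p∣y → p∣C⇒p∤gy {n} {B₀} {g} (∣m⇒∣m*n (P ^ r′ n t) (C≡pC₀⇒p∣C C≡pC₀)) b (∣n⇒∣m*n g p∣y)
        where open Rescalingʳ′ {n} {t} {B₀} {g} C≡pC₀ p∤C₀ n∤2t∸1

      n∣2t∸1⇒𝒴*≃ : ∀ {n t B₀ f g C C₀} .{{_ : NonZero n}} .{{_ : NonZero t}} → C ≡ P * C₀ → ¬ P ∣ C₀ →
                   n ℕD.∣ 2 ℕ.* t ℕ.∸ 1 → f ≡ P ^ t * g →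
                   Equiv n (f * f * B₀) C (λ x y z → Star p t B₀ f x y)
                           (g * g * B₀) C₀ (λ x y z → Star p 0 B₀ g x y × ¬ (P Unsigned.∣ y))
      n∣2t∸1⇒𝒴*≃ {n} {t} {B₀} {g = g} {C₀ = C₀} refl p∤C₀ (ℕD.divides q 2t∸1≡qn) refl =
        scalingEquiv {{p^k≢0 t}} {{p^k≢0 q}} descend′ ascend′
        where
        q-bound : n ℕ.* q < n ℕ.+ (2 ℕ.* t ℕ.∸ 1)
        q-bound = subst₂ (λ a b → a < n ℕ.+ b) (ℕ.*-comm q n) (sym 2t∸1≡qn) (ℕ.m<n+m (q ℕ.* n) (ℕ.>-nonZero⁻¹ n))

        open Rescaling {n} {t} {q} {B₀} {g} {P * C₀} {C₀} {C₀} refl p∤C₀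
                       (a^[2t]*C₀≡a*C₀*a^[qn] P C₀ t q n 2t∸1≡qn) q-bound

        Target : Set
        Target = Obj n (g * g * B₀) C₀ (λ x y _ → Star p 0 B₀ g x y × ¬ (P Unsigned.∣ y))

        descend′ : (a : 𝒴* n B₀ (P ^ t * g) (P * C₀) t) →
                   Σ Target λ b → Scales (P ^ t) (P ^ q) (triple a) (triple b)
        descend′ a@(sol x _ _ _ _ st) with descend a
        ... | sol X y Z solves′ prim′ st′ , a~b@(_ , refl , _) = sol X y Z solves′ prim′ (st′ , p∤y) , a~b
          where
          p∣x : P ∣ x
          p∣x = p^[1+k]∣x⇒p∣x 0 (∣-trans (p^k∣p^m (ℕ.>-nonZero⁻¹ t)) (proj₁ (proj₁ (to (Star⇔ t {B₀} {P ^ t * g} {x}) st))))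
          p∤y : ¬ (P Unsigned.∣ y)
          p∤y p∣y = ¬p∣x×p∣y refl p∤C₀ a p∣x (∣ᵤ⇒∣ p∣y)

        ascend′ : (b : Target) → Σ (𝒴* n B₀ (P ^ t * g) (P * C₀) t) λ a → Scales (P ^ t) (P ^ q) (triple a) (triple b)
        ascend′ (sol X y Z solves prim (st , p∤y)) = ascend (sol X y Z solves prim st) (p∤y ∘ ∣⇒∣ᵤ)

open import Data.Integer.Divisibility using (_∣_)
open import Data.Integer.Divisibility.Signed as Signed using (∣ᵤ⇒∣; ∣⇒∣ᵤ)

lemma6p6 :
    (n : ℕ) → 3 ≤ n → ¬ (2 ℕD.∣ n) →
    (f B₀ C : ℤ) → f ≢ 0ℤ → B₀ ≢ 0ℤ → C ≢ 0ℤ →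
    Squarefree B₀ → B₀ ≢ -[1+ 0 ] →
    (p : ℕ) → Prime p → p ≢ 2 → (+ p) ∣ f → p ^ 1 ∥ C →
    (r : ℕ) → 0 < r → p ^ r ∥ f →
    (t : ℕ) → 0 < t →
      (r < t → Empty n (f * f * B₀) C (λ x y z → Star p t B₀ f x y))
    × (t < r → ¬ (n ℕD.∣ (2 ℕ.* t ℕ.∸ 1)) →
         Empty n (f * f * B₀) C (λ x y z → Star p t B₀ f x y))
    × (t ≡ r → ¬ (n ℕD.∣ (2 ℕ.* t ℕ.∸ 1)) →
         (f₀ : ℤ) → f ≡ (+ p) Data.Integer.^ r * f₀ →
         Equiv n (f * f * B₀) C (λ x y z → Star p t B₀ f x y)
                 (f₀ * f₀ * B₀) (C * (+ p) Data.Integer.^ (r′ n r))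
                 (λ x y z → Star p 0 B₀ f₀ x y))
    × (t ≤ r → n ℕD.∣ (2 ℕ.* t ℕ.∸ 1) →
         (fₜ C₀ : ℤ) → f ≡ (+ p) Data.Integer.^ t * fₜ → C ≡ (+ p) * C₀ →
         Equiv n (f * f * B₀) C (λ x y z → Star p t B₀ f x y)
                 (fₜ * fₜ * B₀) C₀
                 (λ x y z → Star p 0 B₀ fₜ x y × ¬ ((+ p) ∣ y)))
lemma6p6 zero ()
lemma6p6 (suc _) _ _ _ _ _ _ _ _ _ _ _ _ _ _ _ _ _ _ zero ()
lemma6p6 n@(suc _) _ _ f B₀ C _ _ _ _ _ p p-prime p≢2 _ p∥C r _ (p^r∣f , p^[1+r]∤f) t@(suc _) _ =
    (λ r<t → t>r⇒𝒴*-empty p-prime p≢2 {n} {B₀} {f} C≡pC₀ p∤C₀ (p^[1+r]∤f ∘ ∣⇒∣ᵤ) r<t)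
  , (λ t<r → t<r⇒𝒴*-empty p-prime p≢2 {n} {B₀} {f} C≡pC₀ p∤C₀ (∣ᵤ⇒∣ p^r∣f) t<r)
  , t≡r⇒𝒴*≃
  , λ _ n∣2t∸1 _ _ f≡pᵗfₜ C≡pC₀′ →
      n∣2t∸1⇒𝒴*≃ p-prime p≢2 {n} {t} {B₀} C≡pC₀′ (p^1∥C⇒p∤C₀ p-prime {C} p∥C C≡pC₀′) n∣2t∸1 f≡pᵗfₜ
  where
  C₀ : ℤ
  C₀ = proj₁ (p^1∥C⇒C≡pC₀ p-prime {C} p∥C)
  C≡pC₀ : C ≡ (+ p) * C₀
  C≡pC₀ = proj₂ (p^1∥C⇒C≡pC₀ p-prime {C} p∥C)
  p∤C₀ : ¬ ((+ p) Signed.∣ C₀)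
  p∤C₀ = p^1∥C⇒p∤C₀ p-prime {C} p∥C C≡pC₀

  t≡r⇒𝒴*≃ : t ≡ r → ¬ (n ℕD.∣ (2 ℕ.* t ℕ.∸ 1)) → (f₀ : ℤ) → f ≡ (+ p) ^ r * f₀ →
            Equiv n (f * f * B₀) C (λ x y z → Star p t B₀ f x y)
                    (f₀ * f₀ * B₀) (C * (+ p) ^ (r′ n r)) (λ x y z → Star p 0 B₀ f₀ x y)
  t≡r⇒𝒴*≃ refl n∤2t∸1 _ = n∤2t∸1⇒𝒴*≃ p-prime p≢2 {n} {t} {B₀} C≡pC₀ p∤C₀ n∤2t∸1
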